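{- Let $(n,s)$ be a minimal counterexample, let $G\in\mathfrak{E}(n,s)$, and let $Q\subseteq V(G)$ be an independent set of size at least $s-1$. Then there exists an independent set $X\subseteq V(G)$ of size $s$ with $Q\cap X=\emptyset$.
   Context: All graphs are finite and simple. For integers $n\ge s\ge 0$, $\mathrm{ex}(n,s)$ is the maximum number of edges in a triangle-free graph on $n$ vertices with independence number at most $s$, and $\mathfrak{E}(n,s)$ is the family of triangle-free graphs $G$ on $n$ vertices with $\alpha(G)\le s$ and exactly $\mathrm{ex}(n,s)$ edges. Put $g_4(n,s)=6n^2-32ns+44s^2$ and $\delta(n,s)=11s-4n$. A pair of integers $(n,s)$ with $n\ge s\ge0$ is a minimal counterexample if $\mathrm{ex}(n,s)>g_4(n,s)$ and $\mathrm{ex}(n',s')\le g_4(n',s')$ for all integer pairs $n'\ge s'\ge 0$ with $\delta(n',s')<\delta(n,s)$. -}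

module Defs where

open import Data.Nat as ℕ using (ℕ; zero; suc; _+_; _<ᵇ_)
open import Data.Integer as ℤ using (ℤ; +_)
open import Data.Bool using (Bool; true; false; if_then_else_; _∧_)
open import Data.Fin using (Fin; toℕ) renaming (zero to fzero; suc to fsuc)
open import Data.Fin.Subset using (Subset; _∈_; ∣_∣)
open import Data.Product using (_×_)
open import Relation.Nullary using (¬_)
open import Relation.Binary.PropositionalEquality using (_≡_)

record Graph (n : ℕ) : Set where
  field
    adj    : Fin n → Fin n → Bool
    sym    : ∀ i j → adj i j ≡ adj j i
    irrefl : ∀ i → adj i i ≡ false
open Graph public

sumFin : (n : ℕ) → (Fin n → ℕ) → ℕ
sumFin zero    f = 0
sumFin (suc n) f = f fzero + sumFin n (λ i → f (fsuc i))

edges : ∀ {n} → Graph n → ℕ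
edges {n} G = sumFin n (λ i → sumFin n (λ j →
  if (toℕ j <ᵇ toℕ i) ∧ adj G i j then 1 else 0))

TriangleFree : ∀ {n} → Graph n → Set
TriangleFree {n} G = ∀ (i j k : Fin n) →
  ¬ (adj G i j ≡ true × adj G j k ≡ true × adj G i k ≡ true)

Independent : ∀ {n} → Graph n → Subset n → Set
Independent {n} G S = ∀ (i j : Fin n) → i ∈ S → j ∈ S → adj G i j ≡ false

IndepNumAtMost : ∀ {n} → Graph n → ℕ → Set
IndepNumAtMost {n} G s = ∀ (S : Subset n) → Independent G S → ∣ S ∣ ℕ.≤ s

Admissible : ∀ {n} → Graph n → ℕ → Set
Admissible G s = TriangleFree G × IndepNumAtMost G s

-- G ∈ 𝔈(n,s): admissible and with the maximum number of edges among
-- admissible graphs on n vertices (i.e. exactly ex(n,s) edges)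
InE : (n s : ℕ) → Graph n → Set
InE n s G = Admissible G s × (∀ (H : Graph n) → Admissible H s → edges H ℕ.≤ edges G)

g4 : ℕ → ℕ → ℤ
g4 n s = ℤ.+ 6 ℤ.* (+ n) ℤ.* (+ n) ℤ.- ℤ.+ 32 ℤ.* (+ n) ℤ.* (+ s)
         ℤ.+ ℤ.+ 44 ℤ.* (+ s) ℤ.* (+ s)

δ : ℕ → ℕ → ℤ
δ n s = ℤ.+ 11 ℤ.* (+ s) ℤ.- ℤ.+ 4 ℤ.* (+ n)

-- ex(n,s) ≤ g4(n,s): every admissible graph has at most g4(n,s) edges
-- (vacuous when no admissible graph exists, i.e. ex(n,s) = -∞)
ExAtMostG4 : ℕ → ℕ → Set
ExAtMostG4 n s = ∀ (H : Graph n) → Admissible H s → + edges H ℤ.≤ g4 n s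

ExAboveG4 : ℕ → ℕ → Set
ExAboveG4 n s = ¬ ExAtMostG4 n s

MinimalCounterexample : ℕ → ℕ → Set
MinimalCounterexample n s =
  s ℕ.≤ n × ExAboveG4 n s ×
  (∀ (n' s' : ℕ) → s' ℕ.≤ n' → δ n' s' ℤ.< δ n s → ExAtMostG4 n' s')

-- Suppose no s-element independent set of G avoids Q. Adding to G a vertex adjacent exactly to Q
-- gives a triangle-free graph G′ (Q is independent) with α(G′) ≤ s (an independent set through the
-- new vertex avoids Q, so has fewer than s further vertices). As δ(n+1,s) = δ(n,s) − 4, minimality
-- gives ∣Q∣ + e(G) = e(G′) ≤ g4(n+1,s), and since neighbourhoods in G′ are independent,
-- 2(∣Q∣ + e(G)) ≤ (n+1)s. With ∣Q∣ ≥ s − 1 the first bound yields e(G) ≤ g4(n,s) when 33s > 12n + 6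
-- and the second one does otherwise. As G is extremal, ex(n,s) = e(G) ≤ g4(n,s): a contradiction.
module Submission where

open import Algebra.Properties.AbelianGroup using (//-rightDividesˡ; //-rightDividesʳ)
open import Data.Bool as Bool using (Bool; true; false; if_then_else_; _∧_; T)
open import Data.Bool.Properties using (T-≡)
open import Data.Empty using (⊥; ⊥-elim)
open import Data.Fin using (Fin; toℕ) renaming (zero to fzero; suc to fsuc)
open import Data.Fin.Properties using (toℕ-injective; all?)
open import Data.Fin.Subset using (Subset; _∈_; ∣_∣; _⊆_) renaming (⊥ to ∅)
open import Data.Fin.Subset.Properties using (_∈?_; ∉⊥; ∣⊥∣≡0; anySubset?)
open import Data.Integer as ℤ using (ℤ; +_; +≤+)
import Data.Integer.Properties as ℤ
import Data.Integer.Tactic.RingSolver as ℤ-Solver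
open import Data.Nat
open import Data.Nat.Divisibility using (_∣?_; divides)
open import Data.Nat.Properties
open import Data.Nat.Tactic.RingSolver using (solve-∀)
open import Data.Product using (Σ; _×_; _,_; ∃; proj₁; proj₂)
open import Data.Sum using (_⊎_; inj₁; inj₂)
open import Data.Vec using ([]; _∷_; here; there; lookup; tabulate)
open import Data.Vec.Properties using (lookup∘tabulate; []=⇒lookup; lookup⇒[]=)
open import Function using (_∘_; _⇔_; mk⇔; module Equivalence)
open import Relation.Nullary using (Dec; yes; no; contradiction)
open import Relation.Nullary.Decidable using (from-no; _→-dec_; _×-dec_; ¬?)
open import Relation.Binary.PropositionalEquality

open import Algebra.Properties.CommutativeMonoid.Sum +-0-commutativeMonoid
  using (sum; sum-cong-≗; sum-replicate-zero; ∑-distrib-+; ∑-comm)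
open import Defs renaming (sym to adj-sym)
open Equivalence using (from; to)

≤-by-slack : ∀ {m n} k → n ≡ m + k → m ≤ n
≤-by-slack {m} k refl = m≤m+n m k

4*n≢10 : ∀ n → 4 * n ≢ 10
4*n≢10 n eq = from-no (4 ∣? 10) (divides n (trans (sym eq) (*-comm 4 n)))

4*n≢11 : ∀ n → 4 * n ≢ 11
4*n≢11 n eq = from-no (4 ∣? 11) (divides n (trans (sym eq) (*-comm 4 n)))

-- Opaque: otherwise Agda unfolds these solver-generated proofs when checking the case splits
-- that use them, which takes minutes.
opaque
  slack₀ : ∀ t → 3 * (9 + 11 * t + 0) * (9 + 11 * t + 0) + 352 * suc t * suc t + 4 * suc t
                 ≡ 65 * suc t * (9 + 11 * t + 0) + 8 + (6 + 2 * t)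
  slack₀ = solve-∀

  slack₁ : ∀ u → 3 * (9 + 11 * suc u + 1) * (9 + 11 * suc u + 1) + 352 * suc (suc u) * suc (suc u)
                 + 4 * suc (suc u)
                 ≡ 65 * suc (suc u) * (9 + 11 * suc u + 1) + 8 + (1 + 3 * u)
  slack₁ = solve-∀

  slack₂ : ∀ u → 3 * (9 + 11 * suc u + 2) * (9 + 11 * suc u + 2) + 352 * suc (suc u) * suc (suc u)
                 + 4 * suc (suc u)
                 ≡ 65 * suc (suc u) * (9 + 11 * suc u + 2) + 8 + 4 * u
  slack₂ = solve-∀

  slack₃₊ : ∀ t a → 3 * (9 + 11 * t + suc (suc (suc a))) * (9 + 11 * t + suc (suc (suc a)))
                    + 352 * suc t * suc t + 4 * suc t
                    ≡ 65 * suc t * (9 + 11 * t + suc (suc (suc a))) + 8 + (3 * a * a + 7 * a + a * t + 5 * t)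
  slack₃₊ = solve-∀

  9+11t+b+2≡11[1+t]+b : ∀ t b → 9 + 11 * t + b + 2 ≡ 11 * suc t + b
  9+11t+b+2≡11[1+t]+b = solve-∀

  6[1+n]²+44s²≡ : ∀ n s → 6 * suc n * suc n + 44 * s * s ≡ (6 * n * n + 44 * s * s) + (12 * n + 6)
  6[1+n]²+44s²≡ = solve-∀

  q+e+32[1+n]s≡ : ∀ n s q e → q + e + 32 * suc n * s ≡ (e + 32 * n * s) + (32 * s + q)
  q+e+32[1+n]s≡ = solve-∀

  33s≡32s+s : ∀ s → 33 * s ≡ 32 * s + s
  33s≡32s+s = solve-∀

  3[4n+2]≡12n+6 : ∀ n → 3 * (4 * n + 2) ≡ 12 * n + 6
  3[4n+2]≡12n+6 = solve-∀

  2e+2[1+q]≡2[q+e]+2 : ∀ q e → 2 * e + 2 * suc q ≡ 2 * (q + e) + 2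
  2e+2[1+q]≡2[q+e]+2 = solve-∀

  8[e+32ns]+8s≡ : ∀ n s e → 8 * (e + 32 * n * s) + 8 * s ≡ 4 * (2 * e + 2 * s) + 256 * n * s
  8[e+32ns]+8s≡ = solve-∀

  4[[1+n]s+2]+256ns≡ : ∀ n s → 4 * (suc n * s + 2) + 256 * n * s ≡ 65 * s * (4 * n) + 8 + 4 * s
  4[[1+n]s+2]+256ns≡ = solve-∀

  48n²+352s²+8s≡ : ∀ n s → 3 * (4 * n) * (4 * n) + 352 * s * s + 4 * s + 4 * s
                           ≡ 8 * (6 * n * n + 44 * s * s) + 8 * s
  48n²+352s²+8s≡ = solve-∀

  g4-rearranged : ∀ (n s : ℤ) → + 6 ℤ.* n ℤ.* n ℤ.- + 32 ℤ.* n ℤ.* s ℤ.+ + 44 ℤ.* s ℤ.* s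
                                ≡ (+ 6 ℤ.* n ℤ.* n ℤ.+ + 44 ℤ.* s ℤ.* s) ℤ.- + 32 ℤ.* n ℤ.* s
  g4-rearranged = ℤ-Solver.solve-∀

  δ[1+n]+4≡δ[n] : ∀ (n s : ℤ) → + 1 ℤ.+ (+ 11 ℤ.* s ℤ.- + 4 ℤ.* (+ 1 ℤ.+ n)) ℤ.+ + 3
                                 ≡ + 11 ℤ.* s ℤ.- + 4 ℤ.* n
  δ[1+n]+4≡δ[n] = ℤ-Solver.solve-∀

QuadraticBound : ℕ → ℕ → Set
QuadraticBound N s = 65 * s * N + 8 ≤ 3 * N * N + 352 * s * s + 4 * s

-- 3N² − 65sN + 352s² = (N − 11s)(3N − 32s), so at N = 11s + a the slack is 3a² + as + 4s − 8;
-- for a ≥ −2 it is negative only at (N, s) = (10, 1) and (11, 1). Below, s = 1 + t and a = b − 2.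
quadratic-bound-near-11s : ∀ t b → 9 + 11 * t + b ≢ 10 → 9 + 11 * t + b ≢ 11 →
                           QuadraticBound (9 + 11 * t + b) (suc t)
quadratic-bound-near-11s t       0 _    _    = ≤-by-slack (6 + 2 * t) (slack₀ t)
quadratic-bound-near-11s 0       1 N≢10 _    = contradiction refl N≢10
quadratic-bound-near-11s (suc u) 1 _    _    = ≤-by-slack (1 + 3 * u) (slack₁ u)
quadratic-bound-near-11s 0       2 _    N≢11 = contradiction refl N≢11
quadratic-bound-near-11s (suc u) 2 _    _    = ≤-by-slack (4 * u) (slack₂ u)
quadratic-bound-near-11s t (suc (suc (suc a))) _ _ =
  ≤-by-slack (3 * a * a + 7 * a + a * t + 5 * t) (slack₃₊ t a)

quadratic-bound : ∀ N s → 1 ≤ s → 11 * s ≤ N + 2 → N ≢ 10 → N ≢ 11 → QuadraticBound N s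
quadratic-bound N (suc t) _ 11s≤N+2 N≢10 N≢11 =
  subst (λ M → QuadraticBound M (suc t)) N≡
        (quadratic-bound-near-11s t b (N≢10 ∘ trans (sym N≡)) (N≢11 ∘ trans (sym N≡)))
  where
  b : ℕ
  b = proj₁ (m≤n⇒∃[o]m+o≡n 11s≤N+2)
  N≡ : 9 + 11 * t + b ≡ N
  N≡ = +-cancelʳ-≡ 2 _ N (trans (9+11t+b+2≡11[1+t]+b t b) (proj₂ (m≤n⇒∃[o]m+o≡n 11s≤N+2)))

AtMostG4 : ℕ → ℕ → ℕ → Set
AtMostG4 n s m = m + 32 * n * s ≤ 6 * n * n + 44 * s * s

AtMostG4-zero : ∀ n → AtMostG4 n 0 0
AtMostG4-zero n = subst (_≤ 6 * n * n + 0) (sym (*-zeroʳ (32 * n))) z≤n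

AtMostG4-via-extension : ∀ n s q e → 12 * n + 6 ≤ 32 * s + q →
                         AtMostG4 (suc n) s (q + e) → AtMostG4 n s e
AtMostG4-via-extension n s q e 12n+6≤32s+q bound = +-cancelʳ-≤ (12 * n + 6) _ _ (begin
  (e + 32 * n * s) + (12 * n + 6)          ≤⟨ +-monoʳ-≤ (e + 32 * n * s) 12n+6≤32s+q ⟩
  (e + 32 * n * s) + (32 * s + q)          ≡⟨ q+e+32[1+n]s≡ n s q e ⟨
  q + e + 32 * suc n * s                   ≤⟨ bound ⟩
  6 * suc n * suc n + 44 * s * s           ≡⟨ 6[1+n]²+44s²≡ n s ⟩
  (6 * n * n + 44 * s * s) + (12 * n + 6)  ∎)
  where open ≤-Reasoning

AtMostG4-via-degrees : ∀ n s e → 1 ≤ s → 33 * s ≤ 12 * n + 6 → 2 * e + 2 * s ≤ suc n * s + 2 →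
                       AtMostG4 n s e
AtMostG4-via-degrees n s e 1≤s 33s≤12n+6 degrees = *-cancelˡ-≤ 8 (+-cancelʳ-≤ (8 * s) _ _ (begin
  8 * (e + 32 * n * s) + 8 * s                         ≡⟨ 8[e+32ns]+8s≡ n s e ⟩
  4 * (2 * e + 2 * s) + 256 * n * s                    ≤⟨ +-monoˡ-≤ (256 * n * s) (*-monoʳ-≤ 4 degrees) ⟩
  4 * (suc n * s + 2) + 256 * n * s                    ≡⟨ 4[[1+n]s+2]+256ns≡ n s ⟩
  65 * s * (4 * n) + 8 + 4 * s                         ≤⟨ +-monoˡ-≤ (4 * s) quadratic ⟩
  3 * (4 * n) * (4 * n) + 352 * s * s + 4 * s + 4 * s  ≡⟨ 48n²+352s²+8s≡ n s ⟩
  8 * (6 * n * n + 44 * s * s) + 8 * s                 ∎))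
  where
  open ≤-Reasoning
  11s≤4n+2 : 11 * s ≤ 4 * n + 2
  11s≤4n+2 = *-cancelˡ-≤ 3 (subst₂ _≤_ (*-assoc 3 11 s) (sym (3[4n+2]≡12n+6 n)) 33s≤12n+6)
  quadratic : QuadraticBound (4 * n) s
  quadratic = quadratic-bound (4 * n) s 1≤s 11s≤4n+2 (4*n≢10 n) (4*n≢11 n)

AtMostG4-of-extension : ∀ n s q e → s ≤ suc q → 2 * (q + e) ≤ suc n * s →
                        AtMostG4 (suc n) s (q + e) → AtMostG4 n s e
AtMostG4-of-extension n zero q e _ degrees _ = subst (AtMostG4 n 0) (sym e≡0) (AtMostG4-zero n)
  where
  open ≤-Reasoning
  e≡0 : e ≡ 0
  e≡0 = n≤0⇒n≡0 (begin
    e            ≤⟨ m≤n+m e q ⟩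
    q + e        ≤⟨ m≤m+n (q + e) _ ⟩
    2 * (q + e)  ≤⟨ degrees ⟩
    suc n * 0    ≡⟨ *-zeroʳ (suc n) ⟩
    0            ∎)
AtMostG4-of-extension n s@(suc _) q e s≤1+q degrees bound with 33 * s ≤? 12 * n + 6
... | yes 33s≤12n+6 = AtMostG4-via-degrees n s e (s≤s z≤n) 33s≤12n+6 (begin
  2 * e + 2 * s      ≤⟨ +-monoʳ-≤ (2 * e) (*-monoʳ-≤ 2 s≤1+q) ⟩
  2 * e + 2 * suc q  ≡⟨ 2e+2[1+q]≡2[q+e]+2 q e ⟩
  2 * (q + e) + 2    ≤⟨ +-monoˡ-≤ 2 degrees ⟩
  suc n * s + 2      ∎)
  where open ≤-Reasoning
... | no 33s≰12n+6 = AtMostG4-via-extension n s q e (s≤s⁻¹ (begin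
  suc (12 * n + 6)   ≤⟨ ≰⇒> 33s≰12n+6 ⟩
  33 * s             ≡⟨ 33s≡32s+s s ⟩
  32 * s + s         ≤⟨ +-monoʳ-≤ (32 * s) s≤1+q ⟩
  32 * s + suc q     ≡⟨ +-suc (32 * s) q ⟩
  suc (32 * s + q)   ∎)) bound
  where open ≤-Reasoning

pos-*₃ : ∀ k m n → + (k * m * n) ≡ + k ℤ.* + m ℤ.* + n
pos-*₃ k m n = trans (ℤ.pos-* (k * m) n) (cong (ℤ._* + n) (ℤ.pos-* k m))

g4≡+-+ : ∀ n s → g4 n s ≡ + (6 * n * n + 44 * s * s) ℤ.- + (32 * n * s)
g4≡+-+ n s = begin
  g4 n s
    ≡⟨ g4-rearranged (+ n) (+ s) ⟩
  (+ 6 ℤ.* + n ℤ.* + n ℤ.+ + 44 ℤ.* + s ℤ.* + s) ℤ.- + 32 ℤ.* + n ℤ.* + s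
    ≡⟨ cong₂ ℤ._-_ (cong₂ ℤ._+_ (pos-*₃ 6 n n) (pos-*₃ 44 s s)) (pos-*₃ 32 n s) ⟨
  (+ (6 * n * n) ℤ.+ + (44 * s * s)) ℤ.- + (32 * n * s)
    ≡⟨ cong (ℤ._- + (32 * n * s)) (ℤ.pos-+ (6 * n * n) (44 * s * s)) ⟨
  + (6 * n * n + 44 * s * s) ℤ.- + (32 * n * s)
    ∎
  where open ≡-Reasoning

+m≤+a-+b⇔m+b≤a : ∀ m a b → + m ℤ.≤ + a ℤ.- + b ⇔ m + b ≤ a
+m≤+a-+b⇔m+b≤a m a b = mk⇔
  (λ m≤a-b → ℤ.drop‿+≤+ (subst₂ ℤ._≤_ (sym (ℤ.pos-+ m b))
                                      (//-rightDividesˡ ℤ.+-0-abelianGroup (+ b) (+ a))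
                                      (ℤ.+-monoˡ-≤ (+ b) m≤a-b)))
  (λ m+b≤a → subst (ℤ._≤ + a ℤ.- + b)
                   (trans (cong (ℤ._- + b) (ℤ.pos-+ m b)) (//-rightDividesʳ ℤ.+-0-abelianGroup (+ b) (+ m)))
                   (ℤ.+-monoˡ-≤ (ℤ.- + b) (+≤+ m+b≤a)))

≤g4⇔AtMostG4 : ∀ m n s → + m ℤ.≤ g4 n s ⇔ AtMostG4 n s m
≤g4⇔AtMostG4 m n s rewrite g4≡+-+ n s = +m≤+a-+b⇔m+b≤a m (6 * n * n + 44 * s * s) (32 * n * s)

δ[1+n]<δ[n] : ∀ n s → δ (suc n) s ℤ.< δ n s
δ[1+n]<δ[n] n s =
  ℤ.suc[i]≤j⇒i<j (subst (1+δ[1+n] ℤ.≤_) (δ[1+n]+4≡δ[n] (+ n) (+ s)) (ℤ.i≤i+j 1+δ[1+n] (+ 3)))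
  where
  1+δ[1+n] : ℤ
  1+δ[1+n] = ℤ.suc (δ (suc n) s)

sumFin≡sum : ∀ n (f : Fin n → ℕ) → sumFin n f ≡ sum f
sumFin≡sum zero    f = refl
sumFin≡sum (suc n) f = cong (_+_ (f fzero)) (sumFin≡sum n (f ∘ fsuc))

sum≤n*c : ∀ {n} (f : Fin n → ℕ) {c} → (∀ i → f i ≤ c) → sum f ≤ n * c
sum≤n*c {zero}  f f≤c = z≤n
sum≤n*c {suc n} f f≤c = +-mono-≤ (f≤c fzero) (sum≤n*c (f ∘ fsuc) (f≤c ∘ fsuc))

indicator : Bool → ℕ
indicator b = if b then 1 else 0

∣p∣≡sum : ∀ {n} (p : Subset n) → ∣ p ∣ ≡ sum (indicator ∘ lookup p)
∣p∣≡sum []          = refl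
∣p∣≡sum (true ∷ p)  = cong suc (∣p∣≡sum p)
∣p∣≡sum (false ∷ p) = ∣p∣≡sum p

module _ {m : ℕ} (H : Graph m) where

  degree : Fin m → ℕ
  degree i = sum (λ j → indicator (adj H i j))

  neighbours : Fin m → Subset m
  neighbours i = tabulate (adj H i)

  ∈-neighbours : ∀ {i j} → j ∈ neighbours i → adj H i j ≡ true
  ∈-neighbours {i} {j} j∈N = trans (sym (lookup∘tabulate (adj H i) j)) ([]=⇒lookup j∈N)

  neighbours-independent : TriangleFree H → ∀ i → Independent H (neighbours i)
  neighbours-independent triangleFree i j k j∈N k∈N with adj H j k in jk
  ... | false = refl
  ... | true  = ⊥-elim (triangleFree i j k (∈-neighbours j∈N , jk , ∈-neighbours k∈N))

  ∣neighbours∣≡degree : ∀ i → ∣ neighbours i ∣ ≡ degree i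
  ∣neighbours∣≡degree i =
    trans (∣p∣≡sum (neighbours i)) (sum-cong-≗ (cong indicator ∘ lookup∘tabulate (adj H i)))

  degree≤s : ∀ {s} → Admissible H s → ∀ i → degree i ≤ s
  degree≤s (triangleFree , α≤s) i =
    subst (_≤ _) (∣neighbours∣≡degree i) (α≤s (neighbours i) (neighbours-independent triangleFree i))

  -- edges H counts the adjacent pairs below the diagonal; those above it count every edge once more.
  below above : Fin m → Fin m → ℕ
  below i j = indicator ((toℕ j <ᵇ toℕ i) ∧ adj H i j)
  above i j = indicator ((toℕ i <ᵇ toℕ j) ∧ adj H i j)

  edges≡sum-below : edges H ≡ sum (λ i → sum (below i))
  edges≡sum-below = trans (sumFin≡sum m _) (sum-cong-≗ (λ i → sumFin≡sum m (below i)))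

  below+above≡adj : ∀ i j → below i j + above i j ≡ indicator (adj H i j)
  below+above≡adj i j with toℕ j <ᵇ toℕ i in j<i | toℕ i <ᵇ toℕ j in i<j | adj H i j in ij
  ... | true  | true  | _     =
    ⊥-elim (<-asym (<ᵇ⇒< (toℕ j) (toℕ i) (T-≡ .from j<i)) (<ᵇ⇒< (toℕ i) (toℕ j) (T-≡ .from i<j)))
  ... | true  | false | b     = +-identityʳ (indicator b)
  ... | false | true  | _     = refl
  ... | false | false | false = refl
  ... | false | false | true  =
    contradiction (trans (sym ij) (subst (λ k → adj H i k ≡ false) (sym j≡i) (irrefl H i))) λ ()
    where
    j≡i : j ≡ i
    j≡i = toℕ-injective (≤-antisym (≮⇒≥ (subst T i<j ∘ <⇒<ᵇ)) (≮⇒≥ (subst T j<i ∘ <⇒<ᵇ)))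

  above≡below : ∀ i j → above i j ≡ below j i
  above≡below i j = cong (λ b → indicator ((toℕ i <ᵇ toℕ j) ∧ b)) (adj-sym H i j)

  sum-degree≡2*edges : sum degree ≡ 2 * edges H
  sum-degree≡2*edges = begin
    sum degree
      ≡⟨ sum-cong-≗ (λ i → sum-cong-≗ (below+above≡adj i)) ⟨
    sum (λ i → sum (λ j → below i j + above i j))
      ≡⟨ sum-cong-≗ (λ i → ∑-distrib-+ (below i) (above i)) ⟩
    sum (λ i → sum (below i) + sum (above i))
      ≡⟨ ∑-distrib-+ (λ i → sum (below i)) (λ i → sum (above i)) ⟩
    sum (λ i → sum (below i)) + sum (λ i → sum (above i))
      ≡⟨ cong (_+_ (sum (λ i → sum (below i)))) (∑-comm above) ⟩
    sum (λ i → sum (below i)) + sum (λ j → sum (λ i → above i j))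
      ≡⟨ cong (_+_ (sum (λ i → sum (below i)))) (sum-cong-≗ (λ j → sum-cong-≗ (λ i → above≡below i j))) ⟩
    sum (λ i → sum (below i)) + sum (λ j → sum (below j))
      ≡⟨ cong₂ _+_ edges≡sum-below edges≡sum-below ⟨
    edges H + edges H
      ≡⟨ cong (_+_ (edges H)) (+-identityʳ (edges H)) ⟨
    2 * edges H
      ∎
    where open ≡-Reasoning

  2*edges≤m*s : ∀ {s} → Admissible H s → 2 * edges H ≤ m * s
  2*edges≤m*s admissible = subst (_≤ _) sum-degree≡2*edges (sum≤n*c degree (degree≤s admissible))

no-edge-inside : ∀ {n} (G : Graph n) {X j k} → Independent G X →
                 lookup X j ≡ true → lookup X k ≡ true → adj G j k ≡ true → ⊥
no-edge-inside G {X} {j} {k} X-independent j∈X k∈X jk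
  with () ← trans (sym jk) (X-independent j k (lookup⇒[]= j X j∈X) (lookup⇒[]= k X k∈X))

Disjoint : ∀ {n} → Subset n → Subset n → Set
Disjoint {n} p q = ∀ (i : Fin n) → i ∈ p → i ∈ q → ⊥

module _ {n : ℕ} (G : Graph n) (Q : Subset n) where

  addVertexAdj : Fin (suc n) → Fin (suc n) → Bool
  addVertexAdj fzero    fzero    = false
  addVertexAdj fzero    (fsuc j) = lookup Q j
  addVertexAdj (fsuc i) fzero    = lookup Q i
  addVertexAdj (fsuc i) (fsuc j) = adj G i j

  addVertex : Graph (suc n)
  addVertex = record { adj = addVertexAdj ; sym = addVertexAdj-sym ; irrefl = addVertexAdj-irrefl }
    where
    addVertexAdj-sym : ∀ i j → addVertexAdj i j ≡ addVertexAdj j i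
    addVertexAdj-sym fzero    fzero    = refl
    addVertexAdj-sym fzero    (fsuc j) = refl
    addVertexAdj-sym (fsuc i) fzero    = refl
    addVertexAdj-sym (fsuc i) (fsuc j) = adj-sym G i j
    addVertexAdj-irrefl : ∀ i → addVertexAdj i i ≡ false
    addVertexAdj-irrefl fzero    = refl
    addVertexAdj-irrefl (fsuc i) = irrefl G i

  edges-addVertex : edges addVertex ≡ ∣ Q ∣ + edges G
  edges-addVertex = begin
    edges addVertex
      ≡⟨ edges≡sum-below addVertex ⟩
    sum {n} (λ _ → 0) + sum (λ i → indicator (lookup Q i) + sum (below G i))
      ≡⟨ cong₂ _+_ (sum-replicate-zero n) (∑-distrib-+ (indicator ∘ lookup Q) (λ i → sum (below G i))) ⟩
    sum (indicator ∘ lookup Q) + sum (λ i → sum (below G i))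
      ≡⟨ cong₂ _+_ (∣p∣≡sum Q) (edges≡sum-below G) ⟨
    ∣ Q ∣ + edges G
      ∎
    where open ≡-Reasoning

  addVertex-triangleFree : Independent G Q → TriangleFree G → TriangleFree addVertex
  addVertex-triangleFree Q-independent triangleFree = λ where
    fzero    fzero    _        (() , _)
    fzero    (fsuc j) fzero    (_ , _ , ())
    fzero    (fsuc j) (fsuc k) (j∈Q , jk , k∈Q) → no-edge-inside G Q-independent j∈Q k∈Q jk
    (fsuc i) fzero    fzero    (_ , () , _)
    (fsuc i) fzero    (fsuc k) (i∈Q , k∈Q , ik) → no-edge-inside G Q-independent i∈Q k∈Q ik
    (fsuc i) (fsuc j) fzero    (ij , j∈Q , i∈Q) → no-edge-inside G Q-independent i∈Q j∈Q ij
    (fsuc i) (fsuc j) (fsuc k) ijk              → triangleFree i j k ijk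

  independent-tail : ∀ b S → Independent addVertex (b ∷ S) → Independent G S
  independent-tail b S independent i j i∈S j∈S = independent (fsuc i) (fsuc j) (there i∈S) (there j∈S)

  addVertex-indepNum : ∀ {s} → IndepNumAtMost G s →
                       (∀ X → Independent G X → Disjoint Q X → ∣ X ∣ < s) → IndepNumAtMost addVertex s
  addVertex-indepNum α≤s _     (false ∷ S) independent = α≤s S (independent-tail false S independent)
  addVertex-indepNum _   small (true ∷ S)  independent = small S (independent-tail true S independent) disjoint
    where
    disjoint : Disjoint Q S
    disjoint i i∈Q i∈S with () ← trans (sym ([]=⇒lookup i∈Q)) (independent fzero (fsuc i) here (there i∈S))

subset-of-size : ∀ {n} (X : Subset n) k → k ≤ ∣ X ∣ → ∃ λ Y → Y ⊆ X × ∣ Y ∣ ≡ k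
subset-of-size {n} X       zero    _ = ∅ , (λ x∈∅ → contradiction x∈∅ ∉⊥) , ∣⊥∣≡0 n
subset-of-size (false ∷ X) (suc k) 1+k≤∣X∣ with subset-of-size X (suc k) 1+k≤∣X∣
... | Y , Y⊆X , ∣Y∣≡1+k = false ∷ Y , (λ { (there y∈Y) → there (Y⊆X y∈Y) }) , ∣Y∣≡1+k
subset-of-size (true ∷ X)  (suc k) 1+k≤1+∣X∣ with subset-of-size X k (s≤s⁻¹ 1+k≤1+∣X∣)
... | Y , Y⊆X , ∣Y∣≡k = true ∷ Y , (λ { here → here ; (there y∈Y) → there (Y⊆X y∈Y) }) , cong suc ∣Y∣≡k

disjoint? : ∀ {n} (p q : Subset n) → Dec (Disjoint p q)
disjoint? p q = all? λ i → (i ∈? p) →-dec ¬? (i ∈? q)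

module _ {n : ℕ} (G : Graph n) where

  independent? : ∀ X → Dec (Independent G X)
  independent? X = all? λ i → all? λ j → (i ∈? X) →-dec ((j ∈? X) →-dec (adj G i j Bool.≟ false))

  independent-⊆ : ∀ {X Y} → Y ⊆ X → Independent G X → Independent G Y
  independent-⊆ Y⊆X independent i j i∈Y j∈Y = independent i j (Y⊆X i∈Y) (Y⊆X j∈Y)

  avoiding-independent-set-or-small : ∀ s Q →
    (∃ λ X → Independent G X × ∣ X ∣ ≡ s × Disjoint Q X) ⊎
    (∀ X → Independent G X → Disjoint Q X → ∣ X ∣ < s)
  avoiding-independent-set-or-small s Q
    with anySubset? (λ X → independent? X ×-dec disjoint? Q X ×-dec (s ≤? ∣ X ∣))
  ... | no none = inj₂ λ X independent disjoint → ≰⇒> λ s≤∣X∣ → none (X , independent , disjoint , s≤∣X∣)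
  ... | yes (X , independent , disjoint , s≤∣X∣) with subset-of-size X s s≤∣X∣
  ...   | Y , Y⊆X , ∣Y∣≡s =
    inj₁ (Y , independent-⊆ Y⊆X independent , ∣Y∣≡s , λ i i∈Q i∈Y → disjoint i i∈Q (Y⊆X i∈Y))

lemma3p7 : (n s : ℕ) → MinimalCounterexample n s →
    (G : Graph n) → InE n s G →
    (Q : Subset n) → Independent G Q → s ∸ 1 ≤ ∣ Q ∣ →
    Σ (Subset n) (λ X → Independent G X × ∣ X ∣ ≡ s ×
    (∀ (i : Fin n) → i ∈ Q → i ∈ X → ⊥))
lemma3p7 n s (s≤n , exAboveG4 , minimal) G ((triangleFree , α≤s) , extremal) Q Q-independent s∸1≤∣Q∣
  with avoiding-independent-set-or-small G s Q
... | inj₁ X     = X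
... | inj₂ small = contradiction exAtMostG4 exAboveG4
  where
  G′ : Graph (suc n)
  G′ = addVertex G Q
  G′-admissible : Admissible G′ s
  G′-admissible = addVertex-triangleFree G Q Q-independent triangleFree , addVertex-indepNum G Q α≤s small
  G′-within-g4 : AtMostG4 (suc n) s (∣ Q ∣ + edges G)
  G′-within-g4 = subst (AtMostG4 (suc n) s) (edges-addVertex G Q) (≤g4⇔AtMostG4 (edges G′) (suc n) s .to
                   (minimal (suc n) s (m≤n⇒m≤1+n s≤n) (δ[1+n]<δ[n] n s) G′ G′-admissible))
  G′-degrees : 2 * (∣ Q ∣ + edges G) ≤ suc n * s
  G′-degrees = subst (λ e → 2 * e ≤ suc n * s) (edges-addVertex G Q) (2*edges≤m*s G′ G′-admissible)
  G-within-g4 : + edges G ℤ.≤ g4 n s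
  G-within-g4 = ≤g4⇔AtMostG4 (edges G) n s .from (AtMostG4-of-extension n s ∣ Q ∣ (edges G)
                  (≤-trans (m≤n+m∸n s 1) (s≤s s∸1≤∣Q∣)) G′-degrees G′-within-g4)
  exAtMostG4 : ExAtMostG4 n s
  exAtMostG4 H H-admissible = ℤ.≤-trans (+≤+ (extremal H H-admissible)) G-within-g4
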